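{- Let $s<t$ be non-negative integers. For every integer $n\ge 1$, the Toeplitz graphs $G_n(z^s,z)$ and $G_n(z^s+z^t,z)$ are word-representable.
   Context: For a power series $g\in\mathbb{Z}[[z]]$, the Toeplitz graph (Riordan graph of Appell type) $G_n(g,z)$ is the simple graph on vertex set $[n]=\{1,\dots,n\}$ in which distinct vertices $x,y$ are adjacent if and only if the coefficient of $z^{|x-y|-1}$ in $g$ is odd. Thus in $G_n(z^s,z)$, $x\sim y$ iff $|x-y|=s+1$, and in $G_n(z^s+z^t,z)$, $x\sim y$ iff $|x-y|\in\{s+1,t+1\}$. Two distinct letters $x,y$ alternate in a word $w$ if deleting all other letters from $w$ yields a word of the form $xyxy\cdots$ or $yxyx\cdots$ (of even or odd length). A graph $G=(V,E)$ is word-representable if there is a word $w$ over the alphabet $V$ such that for all distinct $x,y\in V$, $x$ and $y$ alternate in $w$ if and only if $xy\in E$. -}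

module Defs where

open import Data.Nat using (ℕ; zero; suc; _+_; _∸_; _≡ᵇ_)
open import Data.Integer using (ℤ; +_)
open import Data.Integer.Base as ℤ using ()
open import Data.Fin using (Fin; toℕ; _≟_)
open import Data.List using (List; []; _∷_; filter)
open import Data.List.Membership.Propositional using (_∈_)
open import Data.Product using (Σ; ∃; _×_)
open import Data.Sum using (_⊎_)
open import Relation.Nullary using (¬_; Dec)
open import Relation.Nullary.Decidable using (_⊎-dec_)
open import Relation.Binary.PropositionalEquality using (_≡_)
open import Function.Bundles using (_⇔_)

Odd : ℕ → Set
Odd m = ∃ λ k → m ≡ suc (k + k)

PowerSeries : Set
PowerSeries = ℕ → ℤ

monomial : ℕ → PowerSeries
monomial s k with k Data.Nat.≟ s
... | Relation.Nullary.yes _ = + 1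
... | Relation.Nullary.no _  = + 0

_+ₚ_ : PowerSeries → PowerSeries → PowerSeries
(f +ₚ g) k = f k ℤ.+ g k

dist : ℕ → ℕ → ℕ
dist a b = (a ∸ b) + (b ∸ a)

record Graph (n : ℕ) : Set₁ where
  field
    Adj : Fin n → Fin n → Set

-- Toeplitz graph G_n(g,z) on [n] (vertex i : Fin n stands for i+1):
-- distinct x,y adjacent iff the coefficient of z^{|x-y|-1} in g is odd.
Toeplitz : (n : ℕ) → PowerSeries → Graph n
Toeplitz n g = record
  { Adj = λ x y → ¬ (x ≡ y) × Odd ℤ.∣ g (dist (toℕ x) (toℕ y) ∸ 1) ∣ }

restrict : {n : ℕ} → Fin n → Fin n → List (Fin n) → List (Fin n)
restrict x y = filter (λ c → (c ≟ x) ⊎-dec (c ≟ y))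

altWord : {A : Set} → A → A → ℕ → List A
altWord x y zero = []
altWord x y (suc k) = x ∷ altWord y x k

Alternate : {n : ℕ} → List (Fin n) → Fin n → Fin n → Set
Alternate w x y = ∃ λ k → (restrict x y w ≡ altWord x y k) ⊎ (restrict x y w ≡ altWord y x k)

WordRepresentable : {n : ℕ} → Graph n → Set
WordRepresentable {n} G =
  Σ (List (Fin n)) λ w →
    ((x : Fin n) → x ∈ w) ×
    ((x y : Fin n) → ¬ (x ≡ y) → (Alternate w x y ⇔ Graph.Adj G x y))

-- A properly 3-coloured graph is word-representable, and both graphs are 3-colourable: a vertex v
-- of G_n(z^s+z^t,z) has at most two neighbours below it, v-(s+1) and v-(t+1), so colouring
-- 1, 2, …, n greedily needs only three colours, and G_n(z^s,z) is a subgraph of it.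
-- For a 3-coloured graph the word is a concatenation of one block per vertex s. A block lists
-- whole colour classes, lower colours first, so adjacent vertices alternate in it, the lower
-- coloured one first. Within the block of s, s and its neighbours are placed so that s occurs
-- twice in a row relative to each vertex of its own colour and to each non-neighbour of suitably
-- chosen colours; every non-adjacent pair is separated in this way by the block of one of its
-- vertices. Whether x and y alternate in the block of s depends only on their colours, on which
-- of them is s and on their adjacency to s, so finitely many cases remain, decided by evaluation.
module Submission where

open import Defs
open import Data.Bool using (Bool; true; false; T; _∧_; not; if_then_else_)
open import Data.Bool.Properties using (T?)
open import Data.Empty using (⊥-elim)
open import Data.Fin using (Fin; zero; suc; toℕ; _≟_)
open import Data.Fin.Properties using (all?; _<?_; toℕ-injective)
open import Data.Integer as ℤ using ()
open import Data.List using (List; []; _∷_; _++_; map; concatMap; filter; filterᵇ; allFin; tabulate)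
open import Data.List.Properties using (filter-++; filter-none; filter-≐; map-++; concatMap-++)
open import Data.List.Membership.Propositional using (_∈_; lose)
open import Data.List.Membership.Propositional.Properties using (∈-allFin; ∈-filter⁺; ∈-concatMap⁺; ∈-++⁺ˡ)
open import Data.List.Relation.Unary.All as All using (All; []; _∷_)
open import Data.List.Relation.Unary.All.Properties using (tabulate⁺)
open import Data.List.Relation.Unary.Any using (here; there)
open import Data.List.Relation.Unary.Linked as Linked using (Linked; []; [-]; _∷_; linked?)
open import Data.List.Relation.Unary.Linked.Properties using (map⁻)
open import Data.Nat using (ℕ; zero; suc; _+_; _∸_; _<_; _≥_; _≤?_; s≤s; z<s)
open import Data.Nat.Properties using (+-suc; suc-injective; +-comm; +-identityʳ; ≤-total; ≤-refl; ≤-trans; m≤n⇒m∸n≡0; m∸n+n≡m; m≤n+m; m+n∸n≡m; ∸-monoʳ-<)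
  renaming (_≟_ to _≟ℕ_)
open import Data.Product using (_×_; _,_; proj₁; proj₂; ∃-syntax)
open import Data.Sum using (_⊎_; inj₁; inj₂)
open import Data.Unit using (⊤; tt)
open import Function using (_∘_; _⇔_; mk⇔)
open import Relation.Binary using (DecidableEquality; Symmetric)
open import Relation.Binary.Definitions using () renaming (Decidable to Decidable₂)
open import Relation.Binary.PropositionalEquality using (_≡_; _≢_; refl; sym; trans; cong; cong₂; subst; subst₂; module ≡-Reasoning)
open import Relation.Nullary using (¬_; Dec; yes; no; does; contradiction)
open import Relation.Nullary.Decidable using (map′; ¬?; _×-dec_; _⊎-dec_; _→-dec_; from-yes; dec-true; dec-false; decidable-stable)
open import Relation.Unary using (Decidable)
open import Relation.Unary.Properties using (_∩?_)

private
  variable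
    A B : Set

pairPower : A → A → ℕ → List A
pairPower a b zero    = []
pairPower a b (suc k) = a ∷ b ∷ pairPower a b k

IsPairPower : A → A → List A → Set
IsPairPower a b w = ∃[ k ] w ≡ pairPower a b k

pairPower-++ : (a b : A) (k m : ℕ) → pairPower a b k ++ pairPower a b m ≡ pairPower a b (k + m)
pairPower-++ a b zero    m = refl
pairPower-++ a b (suc k) m = cong (λ w → a ∷ b ∷ w) (pairPower-++ a b k m)

map-pairPower : (f : A → B) (a b : A) (k : ℕ) → map f (pairPower a b k) ≡ pairPower (f a) (f b) k
map-pairPower f a b zero    = refl
map-pairPower f a b (suc k) = cong (λ w → f a ∷ f b ∷ w) (map-pairPower f a b k)

pairPower≡altWord : (a b : A) (k : ℕ) → pairPower a b k ≡ altWord a b (k + k)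
pairPower≡altWord a b zero = refl
pairPower≡altWord a b (suc k) rewrite +-suc k k = cong (λ w → a ∷ b ∷ w) (pairPower≡altWord a b k)

pairPower? : DecidableEquality A → (a b : A) → Decidable (IsPairPower a b)
pairPower? _≟ᴬ_ a b []          = yes (0 , refl)
pairPower? _≟ᴬ_ a b (c ∷ [])    = no λ { (zero , ()) ; (suc k , ()) }
pairPower? _≟ᴬ_ a b (c ∷ d ∷ w) = map′ cons uncons (c ≟ᴬ a ×-dec d ≟ᴬ b ×-dec pairPower? _≟ᴬ_ a b w)
  where
  cons : c ≡ a × d ≡ b × IsPairPower a b w → IsPairPower a b (c ∷ d ∷ w)
  cons (refl , refl , k , refl) = suc k , refl
  uncons : IsPairPower a b (c ∷ d ∷ w) → c ≡ a × d ≡ b × IsPairPower a b w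
  uncons (suc k , refl) = refl , refl , k , refl

concatMap-pairPower : {a b : A} {f : B → List A} → (∀ i → IsPairPower a b (f i)) →
                      ∀ is → IsPairPower a b (concatMap f is)
concatMap-pairPower f-pow []       = 0 , refl
concatMap-pairPower {a = a} {b} f-pow (i ∷ is) with f-pow i | concatMap-pairPower f-pow is
... | k , eq₁ | m , eq₂ = k + m , trans (cong₂ _++_ eq₁ eq₂) (pairPower-++ a b k m)

altWord-linked : {a b : A} → a ≢ b → ∀ k → Linked _≢_ (altWord a b k)
altWord-linked a≢b zero          = []
altWord-linked a≢b (suc zero)    = [-]
altWord-linked a≢b (suc (suc k)) = a≢b ∷ altWord-linked (a≢b ∘ sym) (suc k)

linked-++⁻ˡ : {R : A → A → Set} (u : List A) {v : List A} → Linked R (u ++ v) → Linked R u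
linked-++⁻ˡ []          _        = []
linked-++⁻ˡ (a ∷ [])    _        = [-]
linked-++⁻ˡ (a ∷ b ∷ u) (r ∷ rs) = r ∷ linked-++⁻ˡ (b ∷ u) rs

linked-++⁻ʳ : {R : A → A → Set} (u : List A) {v : List A} → Linked R (u ++ v) → Linked R v
linked-++⁻ʳ []      l = l
linked-++⁻ʳ (a ∷ u) l = linked-++⁻ʳ u (Linked.tail l)

¬linked-concatMap : {R : A → A → Set} {f : B → List A} {i : B} {is : List B} →
                    i ∈ is → ¬ Linked R (f i) → ¬ Linked R (concatMap f is)
¬linked-concatMap {f = f} {i = i} (here refl) ¬l l = ¬l (linked-++⁻ˡ (f i) l)
¬linked-concatMap {f = f} {is = j ∷ _} (there i∈) ¬l l = ¬linked-concatMap i∈ ¬l (linked-++⁻ʳ (f j) l)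

¬linked-map : (f : A → B) {w : List A} → ¬ Linked _≢_ w → ¬ Linked _≢_ (map f w)
¬linked-map f ¬l l = ¬l (Linked.map (λ fa≢fb a≡b → fa≢fb (cong f a≡b)) (map⁻ l))

filter-filter : {P Q : A → Set} (P? : Decidable P) (Q? : Decidable Q) (xs : List A) →
                filter P? (filter Q? xs) ≡ filter (Q? ∩? P?) xs
filter-filter P? Q? []       = refl
filter-filter P? Q? (x ∷ xs) with does (Q? x)
... | false = filter-filter P? Q? xs
... | true with does (P? x)
...   | true  = cong (x ∷_) (filter-filter P? Q? xs)
...   | false = filter-filter P? Q? xs

filter-concatMap : {P : A → Set} (P? : Decidable P) (f : B → List A) (is : List B) →
                   filter P? (concatMap f is) ≡ concatMap (filter P? ∘ f) is
filter-concatMap P? f []       = refl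
filter-concatMap P? f (i ∷ is) =
  trans (filter-++ P? (f i) _) (cong (filter P? (f i) ++_) (filter-concatMap P? f is))

filter-≟-tabulate-suc : ∀ {m n} (g : Fin m → Fin n) (x : Fin n) →
                        filter (_≟ suc x) (tabulate (suc ∘ g)) ≡ map suc (filter (_≟ x) (tabulate g))
filter-≟-tabulate-suc {zero}  g x = refl
filter-≟-tabulate-suc {suc m} g x with does (g zero ≟ x)
... | true  = cong (suc (g zero) ∷_) (filter-≟-tabulate-suc (g ∘ suc) x)
... | false = filter-≟-tabulate-suc (g ∘ suc) x

filter-≟-allFin : ∀ {n} (x : Fin n) → filter (_≟ x) (allFin n) ≡ x ∷ []
filter-≟-allFin zero    = cong (zero ∷_) (filter-none (_≟ zero) (tabulate⁺ {f = suc} λ _ ()))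
filter-≟-allFin (suc x) = trans (filter-≟-tabulate-suc (λ i → i) x) (cong (map suc) (filter-≟-allFin x))

Colour : Set
Colour = Fin 3

pattern c₀ = zero
pattern c₁ = suc zero
pattern c₂ = suc (suc zero)

data Letter : Set where
  X Y : Letter

_≟ᴸ_ : DecidableEquality Letter
X ≟ᴸ X = yes refl
Y ≟ᴸ Y = yes refl
X ≟ᴸ Y = no λ ()
Y ≟ᴸ X = no λ ()

swap : Letter → Letter
swap X = Y
swap Y = X

record Profile : Set where
  constructor ⟨_,_,_⟩
  field
    colour    : Colour
    isOwner   : Bool
    adjacent  : Bool

data Segment : Set where
  every owner others neighbours nonNeighbours : Colour → Segment

selects : Segment → Profile → Bool
selects (every c)         ⟨ c′ , o , a ⟩ = does (c′ ≟ c)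
selects (owner c)         ⟨ c′ , o , a ⟩ = does (c′ ≟ c) ∧ o
selects (others c)        ⟨ c′ , o , a ⟩ = does (c′ ≟ c) ∧ not o
selects (neighbours c)    ⟨ c′ , o , a ⟩ = does (c′ ≟ c) ∧ a
selects (nonNeighbours c) ⟨ c′ , o , a ⟩ = does (c′ ≟ c) ∧ not a

ownerLast ownerFirst : Colour → List Segment
ownerLast  c = others c ∷ owner c ∷ []
ownerFirst c = owner c ∷ others c ∷ []

-- Listing the colour classes twice, with the owner last and then first, makes the owner
-- occur twice in a row relative to any other vertex of its colour.
classPass : List Segment
classPass = concatMap ownerLast (allFin 3) ++ concatMap ownerFirst (allFin 3)

-- The pass of a c₀-vertex does the same relative to its non-neighbours of colour c₂, that of a
-- c₁-vertex relative to its non-neighbours of colours c₀ and c₂ (compare killer below).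
neighbourPass : Colour → List Segment
neighbourPass c₀ = every c₀ ∷ every c₁ ∷ neighbours c₂ ∷ owner c₀ ∷ nonNeighbours c₂ ∷ others c₀
                 ∷ every c₁ ∷ every c₂ ∷ []
neighbourPass c₁ = every c₀ ∷ others c₁ ∷ nonNeighbours c₂ ∷ owner c₁ ∷ neighbours c₂
                 ∷ neighbours c₀ ∷ owner c₁ ∷ nonNeighbours c₀ ∷ others c₁ ∷ every c₂ ∷ []
neighbourPass c₂ = []

plan : Colour → List Segment
plan c = classPass ++ neighbourPass c

owner∈plan : ∀ c → owner c ∈ plan c
owner∈plan c = ∈-++⁺ˡ {ys = neighbourPass c} (∈-++⁺ˡ {ys = concatMap ownerFirst (allFin 3)}
  (∈-concatMap⁺ ownerLast (lose (∈-allFin c) (there (here refl)))))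

selected : Bool → Bool → List Letter
selected true  false = X ∷ []
selected false true  = Y ∷ []
selected false false = []
selected true  true  = X ∷ Y ∷ []   -- excluded by Separated below

trace : List Segment → Profile × Profile → List Letter
trace segs (πx , πy) = concatMap (λ σ → selected (selects σ πx) (selects σ πy)) segs

Separated : List Segment → Profile × Profile → Set
Separated segs (πx , πy) = All (λ σ → ¬ (T (selects σ πx) × T (selects σ πy))) segs

separated? : ∀ segs π → Dec (Separated segs π)
separated? segs (πx , πy) = All.all? (λ σ → ¬? (T? (selects σ πx) ×-dec T? (selects σ πy))) segs

-- The owner of a block as seen from a pair x, y: one of the two, or a third vertex given by
-- its colour and its adjacency to x and to y.
data Owner : Set where
  member    : Letter → Owner
  bystander : Colour → Bool → Bool → Owner

ownerColour : Colour → Colour → Owner → Colour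
ownerColour cx cy (member X)        = cx
ownerColour cx cy (member Y)        = cy
ownerColour cx cy (bystander c _ _) = c

profiles : Colour → Colour → Bool → Owner → Profile × Profile
profiles cx cy e (member X)          = ⟨ cx , true , false ⟩ , ⟨ cy , false , e ⟩
profiles cx cy e (member Y)          = ⟨ cx , false , e ⟩ , ⟨ cy , true , false ⟩
profiles cx cy e (bystander _ ax ay) = ⟨ cx , false , ax ⟩ , ⟨ cy , false , ay ⟩

Consistent : Colour → Colour → Owner → Set
Consistent cx cy (member _)          = ⊤
Consistent cx cy (bystander c ax ay) = (T ax → c ≢ cx) × (T ay → c ≢ cy)

consistent? : ∀ cx cy o → Dec (Consistent cx cy o)
consistent? cx cy (member _)          = yes tt
consistent? cx cy (bystander c ax ay) = (T? ax →-dec ¬? (c ≟ cx)) ×-dec (T? ay →-dec ¬? (c ≟ cy))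

all-Bool? : {P : Bool → Set} → Decidable P → Dec (∀ b → P b)
all-Bool? P? = map′ (λ (pt , pf) → λ { true → pt ; false → pf }) (λ h → h true , h false)
                    (P? true ×-dec P? false)

all-Owner? : {P : Owner → Set} → Decidable P → Dec (∀ o → P o)
all-Owner? P? = map′ (λ (px , py , pb) → λ { (member X) → px ; (member Y) → py
                                           ; (bystander c a b) → pb c a b })
                     (λ h → h (member X) , h (member Y) , λ c a b → h (bystander c a b))
                     (P? (member X) ×-dec P? (member Y) ×-dec
                      all? λ c → all-Bool? λ a → all-Bool? λ b → P? (bystander c a b))

lower : Colour → Colour → Letter
lower cx cy = if does (cx <? cy) then X else Y

killer : Colour → Colour → Letter
killer c₁ _  = X
killer _  c₁ = Y
killer c₀ _  = X
killer _  _  = Y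

TraceAlternates : List Segment → Profile × Profile → Letter → Set
TraceAlternates segs π p = Separated segs π × IsPairPower p (swap p) (trace segs π)

traceAlternates? : ∀ segs π p → Dec (TraceAlternates segs π p)
traceAlternates? segs π p = separated? segs π ×-dec pairPower? _≟ᴸ_ p (swap p) (trace segs π)

TraceStutters : List Segment → Profile × Profile → Set
TraceStutters segs π = Separated segs π × ¬ Linked _≢_ (trace segs π)

traceStutters? : ∀ segs π → Dec (TraceStutters segs π)
traceStutters? segs π = separated? segs π ×-dec ¬? (linked? (λ a b → ¬? (a ≟ᴸ b)) (trace segs π))

edge-trace-alternates : ∀ cx cy o → cx ≢ cy → Consistent cx cy o →
                        TraceAlternates (plan (ownerColour cx cy o)) (profiles cx cy true o) (lower cx cy)
edge-trace-alternates = from-yes (all? λ cx → all? λ cy → all-Owner? λ o →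
  ¬? (cx ≟ cy) →-dec consistent? cx cy o →-dec
  traceAlternates? (plan (ownerColour cx cy o)) (profiles cx cy true o) (lower cx cy))

sameColour-trace-stutters : ∀ cx cy → cx ≡ cy → TraceStutters classPass (profiles cx cy false (member X))
sameColour-trace-stutters = from-yes (all? λ cx → all? λ cy →
  cx ≟ cy →-dec traceStutters? classPass (profiles cx cy false (member X)))

killer-trace-stutters : ∀ cx cy → cx ≢ cy → let k = killer cx cy in
  TraceStutters (neighbourPass (ownerColour cx cy (member k))) (profiles cx cy false (member k))
killer-trace-stutters = from-yes (all? λ cx → all? λ cy → let k = killer cx cy in
  ¬? (cx ≟ cy) →-dec
  traceStutters? (neighbourPass (ownerColour cx cy (member k))) (profiles cx cy false (member k)))

-- Word-representability of 3-coloured graphs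

T-does⇒ : {P : Set} (p? : Dec P) → T (does p?) → P
T-does⇒ (yes p) _ = p

module ThreeColoured {n : ℕ} (G : Graph n)
  (adj? : Decidable₂ (Graph.Adj G)) (adj-sym : Symmetric (Graph.Adj G))
  (colour : Fin n → Colour) (proper : ∀ {x y} → Graph.Adj G x y → colour x ≢ colour y) where

  open Graph G

  profile : Fin n → Fin n → Profile
  profile s c = ⟨ colour c , does (c ≟ s) , does (adj? s c) ⟩

  segment : Fin n → Segment → List (Fin n)
  segment s σ = filterᵇ (λ c → selects σ (profile s c)) (allFin n)

  block : Fin n → List (Fin n)
  block s = concatMap (segment s) (plan (colour s))

  word : List (Fin n)
  word = concatMap block (allFin n)

  owner-selects-itself : ∀ s → T (selects (owner (colour s)) (profile s s))
  owner-selects-itself s rewrite dec-true (colour s ≟ colour s) refl | dec-true (s ≟ s) refl = tt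

  owner∈block : ∀ s → s ∈ block s
  owner∈block s = ∈-concatMap⁺ (segment s) (lose (owner∈plan (colour s))
    (∈-filter⁺ (T? ∘ λ c → selects (owner (colour s)) (profile s c)) (∈-allFin s) (owner-selects-itself s)))

  word-complete : ∀ x → x ∈ word
  word-complete x = ∈-concatMap⁺ block (lose (∈-allFin x) (owner∈block x))

  does-adj-sym : ∀ x y → does (adj? y x) ≡ does (adj? x y)
  does-adj-sym x y with adj? x y | adj? y x
  ... | yes _  | yes _  = refl
  ... | no _   | no _   = refl
  ... | yes xy | no ¬yx = contradiction (adj-sym xy) ¬yx
  ... | no ¬xy | yes yx = contradiction (adj-sym yx) ¬xy

  module _ {x y : Fin n} (x≢y : x ≢ y) where

    letter : Letter → Fin n
    letter X = x
    letter Y = y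

    restrict-filterᵇ : (Q : Fin n → Bool) → ¬ (T (Q x) × T (Q y)) →
                       restrict x y (filterᵇ Q (allFin n)) ≡ map letter (selected (Q x) (Q y))
    restrict-filterᵇ Q ¬both =
      trans (filter-filter inPair? (T? ∘ Q) (allFin n)) (select (Q x) (Q y) refl refl)
      where
      inPair? : Decidable (λ c → c ≡ x ⊎ c ≡ y)
      inPair? c = (c ≟ x) ⊎-dec (c ≟ y)

      Selected : Fin n → Set
      Selected c = T (Q c) × (c ≡ x ⊎ c ≡ y)

      selected? : Decidable Selected
      selected? = (T? ∘ Q) ∩? inPair?

      select : ∀ bx by → Q x ≡ bx → Q y ≡ by → filter selected? (allFin n) ≡ map letter (selected bx by)
      select true  true  qx qy = contradiction (subst T (sym qx) _ , subst T (sym qy) _) ¬both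
      select true  false qx qy =
        trans (filter-≐ selected? (_≟ x) (only-x , λ { refl → subst T (sym qx) _ , inj₁ refl }) (allFin n))
              (filter-≟-allFin x)
        where
        only-x : ∀ {c} → Selected c → c ≡ x
        only-x (_ , inj₁ c≡x)  = c≡x
        only-x (q , inj₂ refl) = ⊥-elim (subst T qy q)
      select false true  qx qy =
        trans (filter-≐ selected? (_≟ y) (only-y , λ { refl → subst T (sym qy) _ , inj₂ refl }) (allFin n))
              (filter-≟-allFin y)
        where
        only-y : ∀ {c} → Selected c → c ≡ y
        only-y (q , inj₁ refl) = ⊥-elim (subst T qx q)
        only-y (_ , inj₂ c≡y)  = c≡y
      select false false qx qy = filter-none selected? (tabulate⁺ {f = λ i → i} λ _ → none)
        where
        none : ∀ {c} → ¬ Selected c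
        none (q , inj₁ refl) = subst T qx q
        none (q , inj₂ refl) = subst T qy q

    pairProfile : Fin n → Profile × Profile
    pairProfile s = profile s x , profile s y

    restrict-segments : ∀ s segs → Separated segs (pairProfile s) →
                        restrict x y (concatMap (segment s) segs) ≡ map letter (trace segs (pairProfile s))
    restrict-segments s []         []           = refl
    restrict-segments s (σ ∷ segs) (sep ∷ seps) = begin
      restrict x y (segment s σ ++ concatMap (segment s) segs)
        ≡⟨ filter-++ _ (segment s σ) _ ⟩
      restrict x y (segment s σ) ++ restrict x y (concatMap (segment s) segs)
        ≡⟨ cong₂ _++_ (restrict-filterᵇ _ sep) (restrict-segments s segs seps) ⟩
      map letter head-trace ++ map letter (trace segs (pairProfile s))
        ≡⟨ map-++ letter head-trace (trace segs (pairProfile s)) ⟨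
      map letter (trace (σ ∷ segs) (pairProfile s)) ∎
      where
      open ≡-Reasoning
      head-trace : List Letter
      head-trace = selected (selects σ (profile s x)) (selects σ (profile s y))

    Describes : Bool → Fin n → Owner → Set
    Describes e s o = colour s ≡ ownerColour (colour x) (colour y) o
                    × pairProfile s ≡ profiles (colour x) (colour y) e o

    describes-member : ∀ {e} → does (adj? x y) ≡ e → ∀ l → Describes e (letter l) (member l)
    describes-member refl X
      rewrite dec-true (x ≟ x) refl | dec-false (adj? x x) (λ xx → proper xx refl) | dec-false (y ≟ x) (x≢y ∘ sym)
      = refl , refl
    describes-member refl Y
      rewrite dec-true (y ≟ y) refl | dec-false (adj? y y) (λ yy → proper yy refl) | dec-false (x ≟ y) x≢y
            | does-adj-sym x y
      = refl , refl

    describe : ∀ {e} → does (adj? x y) ≡ e → ∀ s → ∃[ o ] Consistent (colour x) (colour y) o × Describes e s o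
    describe edge s = classify (x ≟ s) (y ≟ s)
      where
      classify : Dec (x ≡ s) → Dec (y ≡ s) → ∃[ o ] Consistent (colour x) (colour y) o × Describes _ s o
      classify (yes refl) _          = member X , tt , describes-member edge X
      classify (no _)     (yes refl) = member Y , tt , describes-member edge Y
      classify (no x≢s)   (no y≢s)   rewrite dec-false (x ≟ s) x≢s | dec-false (y ≟ s) y≢s =
        bystander (colour s) (does (adj? s x)) (does (adj? s y)) ,
        (proper ∘ T-does⇒ (adj? s x) , proper ∘ T-does⇒ (adj? s y)) , refl , refl

    restrict-described : ∀ {e} s o (segs : Colour → List Segment) → Describes e s o →
      let π = profiles (colour x) (colour y) e o ; segs′ = segs (ownerColour (colour x) (colour y) o) in
      Separated segs′ π → restrict x y (concatMap (segment s) (segs (colour s))) ≡ map letter (trace segs′ π)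
    restrict-described s o segs (c≡ , π≡) sep =
      trans (restrict-segments s (segs (colour s)) (subst₂ (Separated ∘ segs) (sym c≡) (sym π≡) sep))
            (cong₂ (λ c π → map letter (trace (segs c) π)) c≡ π≡)

    stutters-described : ∀ {e} s o (segs : Colour → List Segment) → Describes e s o →
      let π = profiles (colour x) (colour y) e o ; segs′ = segs (ownerColour (colour x) (colour y) o) in
      TraceStutters segs′ π → ¬ Linked _≢_ (restrict x y (concatMap (segment s) (segs (colour s))))
    stutters-described s o segs desc (sep , ¬linked) =
      ¬linked-map letter ¬linked ∘ subst (Linked _≢_) (restrict-described s o segs desc sep)

    restrict-block : ∀ s → restrict x y (block s) ≡ restrict x y (concatMap (segment s) classPass)
                                                   ++ restrict x y (concatMap (segment s) (neighbourPass (colour s)))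
    restrict-block s = trans (cong (restrict x y) (concatMap-++ (segment s) classPass (neighbourPass (colour s))))
                             (filter-++ _ (concatMap (segment s) classPass) _)

    block-alternates : Adj x y → ∀ s → let p = lower (colour x) (colour y) in
                       IsPairPower (letter p) (letter (swap p)) (restrict x y (block s))
    block-alternates xy s =
      let o , consistent , desc = describe (dec-true (adj? x y) xy) s
          sep , k , trace≡ = edge-trace-alternates (colour x) (colour y) o (proper xy) consistent
      in k , trans (restrict-described s o plan desc sep)
                   (trans (cong (map letter) trace≡) (map-pairPower letter _ _ k))

    block-stutters : ¬ Adj x y → ∃[ s ] ¬ Linked _≢_ (restrict x y (block s))
    block-stutters ¬xy = by-colours (colour x ≟ colour y)
      where
      non-edge : ∀ l → Describes false (letter l) (member l)
      non-edge = describes-member (dec-false (adj? x y) ¬xy)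

      by-colours : Dec (colour x ≡ colour y) → ∃[ s ] ¬ Linked _≢_ (restrict x y (block s))
      by-colours (yes cx≡cy) =
        x , stutters-described x (member X) (λ _ → classPass) (non-edge X)
              (sameColour-trace-stutters (colour x) (colour y) cx≡cy)
            ∘ linked-++⁻ˡ (restrict x y (concatMap (segment x) classPass)) ∘ subst (Linked _≢_) (restrict-block x)
      by-colours (no cx≢cy) =
        let k = killer (colour x) (colour y) in
        letter k , stutters-described (letter k) (member k) neighbourPass (non-edge k)
                     (killer-trace-stutters (colour x) (colour y) cx≢cy)
                   ∘ linked-++⁻ʳ (restrict x y (concatMap (segment (letter k)) classPass))
                   ∘ subst (Linked _≢_) (restrict-block (letter k))

    word-alternates : Adj x y → let p = lower (colour x) (colour y) in
                      IsPairPower (letter p) (letter (swap p)) (restrict x y word)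
    word-alternates xy = subst (IsPairPower _ _) (sym (filter-concatMap _ block (allFin n)))
                               (concatMap-pairPower (block-alternates xy) (allFin n))

    word-stutters : ¬ Adj x y → ¬ Linked _≢_ (restrict x y word)
    word-stutters ¬xy = let s , ¬linked = block-stutters ¬xy in
      ¬linked-concatMap (∈-allFin s) ¬linked ∘ subst (Linked _≢_) (filter-concatMap _ block (allFin n))

    pairPower⇒alternate : ∀ {w} l → IsPairPower (letter l) (letter (swap l)) (restrict x y w) → Alternate w x y
    pairPower⇒alternate X (k , eq) = k + k , inj₁ (trans eq (pairPower≡altWord x y k))
    pairPower⇒alternate Y (k , eq) = k + k , inj₂ (trans eq (pairPower≡altWord y x k))

    alternate⇒linked : ∀ {w} → Alternate w x y → Linked _≢_ (restrict x y w)
    alternate⇒linked (k , inj₁ eq) = subst (Linked _≢_) (sym eq) (altWord-linked x≢y k)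
    alternate⇒linked (k , inj₂ eq) = subst (Linked _≢_) (sym eq) (altWord-linked (x≢y ∘ sym) k)

    alternate⇔adj : Alternate word x y ⇔ Adj x y
    alternate⇔adj =
      mk⇔ (λ alt → decidable-stable (adj? x y) λ ¬xy → word-stutters ¬xy (alternate⇒linked {word} alt))
                        (pairPower⇒alternate {word} _ ∘ word-alternates)

  wordRepresentable : WordRepresentable G
  wordRepresentable = word , word-complete , λ x y x≢y → alternate⇔adj x≢y

-- Toeplitz graphs

odd? : Decidable Odd
odd? zero                = no λ ()
odd? (suc zero)          = yes (0 , refl)
odd? (suc (suc m))       = map′ step unstep (odd? m)
  where
  step : Odd m → Odd (suc (suc m))
  step (k , refl) = suc k , cong (λ m → suc (suc m)) (sym (+-suc k k))
  unstep : Odd (suc (suc m)) → Odd m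
  unstep (suc k , eq) = k , trans (suc-injective (suc-injective eq)) (+-suc k k)

dist-sym : ∀ a b → dist a b ≡ dist b a
dist-sym a b = +-comm (a ∸ b) (b ∸ a)

dist≡⇒ : ∀ a b d → dist a b ≡ d → b ≡ a + d ⊎ a ≡ b + d
dist≡⇒ a b d eq with ≤-total a b
... | inj₁ a≤b rewrite m≤n⇒m∸n≡0 a≤b =
  inj₁ (trans (sym (m∸n+n≡m a≤b)) (trans (cong (_+ a) eq) (+-comm d a)))
... | inj₂ b≤a rewrite m≤n⇒m∸n≡0 b≤a | +-identityʳ (a ∸ b) =
  inj₂ (trans (sym (m∸n+n≡m b≤a)) (trans (cong (_+ b) eq) (+-comm d b)))

dist-pred : ∀ {a b} → a ≢ b → dist a b ≡ suc (dist a b ∸ 1)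
dist-pred {a} {b} a≢b with dist a b in eq
... | suc d = refl
... | zero with dist≡⇒ a b 0 eq
...   | inj₁ b≡a+0 = contradiction (sym (trans b≡a+0 (+-identityʳ a))) a≢b
...   | inj₂ a≡b+0 = contradiction (trans a≡b+0 (+-identityʳ b)) a≢b

toeplitz-adj? : ∀ n g → Decidable₂ (Graph.Adj (Toeplitz n g))
toeplitz-adj? n g x y = ¬? (x ≟ y) ×-dec odd? ℤ.∣ g (dist (toℕ x) (toℕ y) ∸ 1) ∣

toeplitz-sym : ∀ n g → Symmetric (Graph.Adj (Toeplitz n g))
toeplitz-sym n g {x} {y} (x≢y , odd) =
  x≢y ∘ sym , subst (λ d → Odd ℤ.∣ g (d ∸ 1) ∣) (dist-sym (toℕ x) (toℕ y)) odd

avoid : Colour → Colour → Colour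
avoid c₀ c₁ = c₂
avoid c₁ c₀ = c₂
avoid c₀ _  = c₁
avoid _  c₀ = c₁
avoid _  _  = c₀

avoid-fresh : ∀ a b → avoid a b ≢ a × avoid a b ≢ b
avoid-fresh = from-yes (all? λ a → all? λ b → ¬? (avoid a b ≟ a) ×-dec ¬? (avoid a b ≟ b))

module Greedy (s t : ℕ) where

  earlier : (ℕ → Colour) → ℕ → ℕ → Colour
  earlier f d v with d ≤? v
  ... | yes _ = f (v ∸ d)
  ... | no _  = c₀

  earlier-cong : ∀ {f g} d v → (∀ w → w < v → f w ≡ g w) → earlier f (suc d) v ≡ earlier g (suc d) v
  earlier-cong d v f≗g with suc d ≤? v
  ... | yes d<v = f≗g (v ∸ suc d) (∸-monoʳ-< z<s d<v)
  ... | no _    = refl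

  earlier-at : ∀ f d u → earlier f d (u + d) ≡ f u
  earlier-at f d u with d ≤? u + d
  ... | yes _   = cong f (m+n∸n≡m u d)
  ... | no d≰ = contradiction (m≤n+m d u) d≰

  -- Colours the vertices 0, 1, … in turn, each avoiding the colours of the vertices suc s and suc t
  -- below it; the first argument is fuel, enough once it exceeds the vertex.
  colourWithin : ℕ → ℕ → Colour
  colourWithin zero    v = c₀
  colourWithin (suc f) v = avoid (earlier (colourWithin f) (suc s) v) (earlier (colourWithin f) (suc t) v)

  colourWithin-stable : ∀ f g v → v < f → v < g → colourWithin f v ≡ colourWithin g v
  colourWithin-stable (suc f) (suc g) v (s≤s v≤f) (s≤s v≤g) =
    cong₂ avoid (earlier-cong s v below) (earlier-cong t v below)
    where
    below : ∀ w → w < v → colourWithin f w ≡ colourWithin g w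
    below w w<v = colourWithin-stable f g w (≤-trans w<v v≤f) (≤-trans w<v v≤g)

  colour : ℕ → Colour
  colour v = colourWithin (suc v) v

  colour-unfold : ∀ v → colour v ≡ avoid (earlier colour (suc s) v) (earlier colour (suc t) v)
  colour-unfold v = cong₂ avoid (earlier-cong s v agree) (earlier-cong t v agree)
    where
    agree : ∀ w → w < v → colourWithin v w ≡ colour w
    agree w w<v = colourWithin-stable v (suc w) w w<v (s≤s ≤-refl)

  colour-separates : ∀ u d → d ≡ s ⊎ d ≡ t → colour (u + suc d) ≢ colour u
  colour-separates u d (inj₁ refl) eq = proj₁ (avoid-fresh _ _) (begin
    avoid (earlier colour (suc s) (u + suc s)) _ ≡⟨ colour-unfold (u + suc s) ⟨
    colour (u + suc s)                           ≡⟨ eq ⟩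
    colour u                                     ≡⟨ earlier-at colour (suc s) u ⟨
    earlier colour (suc s) (u + suc s)           ∎)
    where open ≡-Reasoning
  colour-separates u d (inj₂ refl) eq = proj₂ (avoid-fresh _ _) (begin
    avoid _ (earlier colour (suc t) (u + suc t)) ≡⟨ colour-unfold (u + suc t) ⟨
    colour (u + suc t)                           ≡⟨ eq ⟩
    colour u                                     ≡⟨ earlier-at colour (suc t) u ⟨
    earlier colour (suc t) (u + suc t)           ∎)
    where open ≡-Reasoning

  colour-proper : ∀ u v d → d ≡ s ⊎ d ≡ t → dist u v ≡ suc d → colour u ≢ colour v
  colour-proper u v d d∈ eq with dist≡⇒ u v (suc d) eq
  ... | inj₁ refl = colour-separates u d d∈ ∘ sym
  ... | inj₂ refl = colour-separates v d d∈

toeplitz-wordRepresentable : ∀ {s t} n g → (∀ k → Odd ℤ.∣ g k ∣ → k ≡ s ⊎ k ≡ t) →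
                             WordRepresentable (Toeplitz n g)
toeplitz-wordRepresentable {s} {t} n g odd⇒ =
  ThreeColoured.wordRepresentable (Toeplitz n g) (toeplitz-adj? n g) (toeplitz-sym n g) (colour ∘ toℕ) proper
  where
  open Greedy s t
  proper : ∀ {x y} → Graph.Adj (Toeplitz n g) x y → colour (toℕ x) ≢ colour (toℕ y)
  proper {x} {y} (x≢y , odd) = colour-proper (toℕ x) (toℕ y) _ (odd⇒ _ odd) (dist-pred (x≢y ∘ toℕ-injective))

odd-monomial : ∀ s k → Odd ℤ.∣ monomial s k ∣ → k ≡ s
odd-monomial s k odd with k ≟ℕ s
... | yes k≡s = k≡s
odd-monomial s k (_ , ()) | no _

odd-binomial : ∀ s t k → Odd ℤ.∣ (monomial s +ₚ monomial t) k ∣ → k ≡ s ⊎ k ≡ t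
odd-binomial s t k odd with k ≟ℕ s | k ≟ℕ t
... | yes k≡s | _       = inj₁ k≡s
... | no _    | yes k≡t = inj₂ k≡t
odd-binomial s t k (_ , ()) | no _ | no _

theorem1 : (s t : ℕ) → s < t → (n : ℕ) → n ≥ 1 →
    WordRepresentable (Toeplitz n (monomial s)) ×
    WordRepresentable (Toeplitz n (monomial s +ₚ monomial t))
theorem1 s t _ n _ =
  toeplitz-wordRepresentable {s} {s} n (monomial s) (λ k → inj₁ ∘ odd-monomial s k) ,
  toeplitz-wordRepresentable n (monomial s +ₚ monomial t) (odd-binomial s t)
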